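{- Let $q\geq 3$ be odd, let $D$ be the dihedral group of order $2q$ with generators $\sigma,\rho$ satisfying $\sigma^2=\rho^q=1$, $\sigma\rho=\rho^{ -1}\sigma$, and let $G=\langle\rho\rangle$, $\Sigma=\langle\sigma\rangle$, $\Sigma'=\langle\sigma\rho\rangle$. Let $B$ be a uniquely $2$-divisible $D$-module (written additively). Then there are isomorphisms of abelian groups \[ \Bigl(B[N_G]\cap\bigl(B^\Sigma+B^{\Sigma'}\bigr)\Bigr)\big/I_GB\cong\hat H^{ -1}(D,B) \] and \[ B[N_G]\Big/\Bigl(\bigl(B^\Sigma+B^{\Sigma'}\bigr)\cap B[N_G]\Bigr)\cong H^1(D,B). \]
   Context: $N_G=\sum_{g\in G}g$, $B[N_G]$ is the kernel of multiplication by $N_G$ on $B$, $I_G$ is the augmentation ideal of $\mathbb Z[G]$ (so $I_GB=(1-\rho)B$), $B^H$ the $H$-invariants. Uniquely $2$-divisible means multiplication by $2$ is an automorphism. $\hat H^{ -1}$ is Tate cohomology, $H^1$ ordinary cohomology. -}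

module Defs where

open import Level using (Level; _⊔_) renaming (suc to lsuc)
open import Algebra.Bundles using (AbelianGroup)
open import Data.Nat using (ℕ; zero; suc; _+_; _∸_; NonZero)
open import Data.Nat.DivMod using (_mod_)
open import Data.Fin using (Fin; toℕ)
open import Data.Bool using (Bool; true; false; _xor_; if_then_else_)
open import Data.Product using (Σ; _×_; _,_; ∃; ∃-syntax)
open import Function using (_∘_; id)

-- Subquotients: a carrier, a membership predicate (the subgroup), an
-- operation and the relation "congruent modulo the smaller subgroup".
-- The quotient is Mem modulo _≈_.

record SubQuot (a p r : Level) : Set (lsuc (a ⊔ p ⊔ r)) where
  field
    Carrier : Set a
    Mem     : Carrier → Set p
    _≈_     : Carrier → Carrier → Set r
    _·_     : Carrier → Carrier → Carrier

record _≅_ {a p r a' p' r'} (S : SubQuot a p r) (T : SubQuot a' p' r')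
       : Set (a ⊔ p ⊔ r ⊔ a' ⊔ p' ⊔ r') where
  private
    module S = SubQuot S
    module T = SubQuot T
  field
    to   : S.Carrier → T.Carrier
    mem  : ∀ {x} → S.Mem x → T.Mem (to x)
    cong : ∀ {x y} → S.Mem x → S.Mem y → x S.≈ y → to x T.≈ to y
    hom  : ∀ {x y} → S.Mem x → S.Mem y → to (x S.· y) T.≈ (to x T.· to y)
    inj  : ∀ {x y} → S.Mem x → S.Mem y → to x T.≈ to y → x S.≈ y
    surj : ∀ {y} → T.Mem y → ∃[ x ] (S.Mem x × to x T.≈ y)

iter : ∀ {a} {A : Set a} → ℕ → (A → A) → A → A
iter zero    f = id
iter (suc n) f = f ∘ iter n f

-- The dihedral group D of order 2q: the element (i , s) stands for
-- ρ^i σ^s (s = true means σ is present).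

Dih : ℕ → Set
Dih q = Fin q × Bool

-- (ρ^i σ^a)(ρ^j σ^b) = ρ^(i ± j) σ^(a xor b), with - iff a
dmul : (q : ℕ) .{{_ : NonZero q}} → Dih q → Dih q → Dih q
dmul q (i , a) (j , b) =
  ((toℕ i + (if a then q ∸ toℕ j else toℕ j)) mod q) , (a xor b)

module _ {c ℓ} (B : AbelianGroup c ℓ) where
  open AbelianGroup B renaming (Carrier to A)

  _−_ : A → A → A
  x − y = x ∙ (y ⁻¹)

  sumFin : (n : ℕ) → (Fin n → A) → A
  sumFin zero    f = ε
  sumFin (suc n) f = f Fin.zero ∙ sumFin n (f ∘ Fin.suc)
    where import Data.Fin as Fin

  record IsEndo (f : A → A) : Set (c ⊔ ℓ) where
    field
      ≈-cong : ∀ {x y} → x ≈ y → f x ≈ f y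
      ∙-hom  : ∀ x y → f (x ∙ y) ≈ (f x ∙ f y)

  UniquelyTwoDivisible : Set (c ⊔ ℓ)
  UniquelyTwoDivisible =
    (∀ y → ∃[ x ] ((x ∙ x) ≈ y)) × (∀ x y → (x ∙ x) ≈ (y ∙ y) → x ≈ y)

  record DModule (q : ℕ) : Set (c ⊔ ℓ) where
    field
      ρ σ    : A → A
      ρ-endo : IsEndo ρ
      σ-endo : IsEndo σ
      σ²     : ∀ x → σ (σ x) ≈ x
      ρ^q    : ∀ x → iter q ρ x ≈ x
      σρ     : ∀ x → σ (ρ x) ≈ iter (q ∸ 1) ρ (σ x)   -- ρ⁻¹ = ρ^(q-1)

  module _ {q : ℕ} (M : DModule q) where
    open DModule M

    act : Dih q → A → A
    act (i , false) = iter (toℕ i) ρ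
    act (i , true)  = iter (toℕ i) ρ ∘ σ

    sumD : (Dih q → A) → A
    sumD f = sumFin q (λ i → f (i , false)) ∙ sumFin q (λ i → f (i , true))

    NG : A → A
    NG x = sumFin q (λ i → iter (toℕ i) ρ x)

    ND : A → A
    ND x = sumD (λ g → act g x)

    KerNG : A → Set ℓ
    KerNG x = NG x ≈ ε

    KerND : A → Set ℓ
    KerND x = ND x ≈ ε

    IGB : A → Set (c ⊔ ℓ)
    IGB x = ∃[ b ] (x ≈ (b − ρ b))

    IDB : A → Set (c ⊔ ℓ)
    IDB x = Σ (Dih q → A) λ b → (x ≈ sumD (λ g → act g (b g) − b g))

    InvSum : A → Set (c ⊔ ℓ)
    InvSum x = ∃[ u ] ∃[ v ] (σ u ≈ u × σ (ρ v) ≈ v × x ≈ (u ∙ v))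

    Mem₁ : A → Set (c ⊔ ℓ)
    Mem₁ x = KerNG x × InvSum x

    Quot₁ : SubQuot c (c ⊔ ℓ) (c ⊔ ℓ)
    Quot₁ = record
      { Carrier = A
      ; Mem     = Mem₁
      ; _≈_     = λ x y → IGB (x − y)
      ; _·_     = _∙_ }

    Quot₂ : SubQuot c ℓ (c ⊔ ℓ)
    Quot₂ = record
      { Carrier = A
      ; Mem     = KerNG
      ; _≈_     = λ x y → InvSum (x − y) × KerNG (x − y)
      ; _·_     = _∙_ }

    TateHm1 : SubQuot c ℓ (c ⊔ ℓ)
    TateHm1 = record
      { Carrier = A
      ; Mem     = KerND
      ; _≈_     = λ x y → IDB (x − y)
      ; _·_     = _∙_ }

    module _ .{{_ : NonZero q}} where
      IsCrossedHom : (Dih q → A) → Set ℓ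
      IsCrossedHom f = ∀ g h → f (dmul q g h) ≈ (f g ∙ act g (f h))

      H1 : SubQuot c ℓ (c ⊔ ℓ)
      H1 = record
        { Carrier = Dih q → A
        ; Mem     = IsCrossedHom
        ; _≈_     = λ f f' → ∃[ b ] (∀ g → (f g − f' g) ≈ (act g b − b))
        ; _·_     = λ f f' g → f g ∙ f' g }

{-# OPTIONS --safe #-}
module Submission where

-- Both isomorphisms are explicit, and 2 being invertible on B is what makes them work.
-- The first is induced by the identity: N_D = N_G (1 + σ) and σ N_G = N_G σ, so B[N_G] ⊆ B[N_D];
-- I_G B ⊆ I_D B; conversely 1 + σ maps I_D B into I_G B while x − σ x ∈ I_G B for
-- x ∈ B^Σ + B^Σ', so 2x ∈ I_G B for such x in I_D B; and y ∈ B[N_D] is congruent modulo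
-- I_D B to the σ-invariant element (y + σ y)/2 of B[N_G].
-- The second sends x ∈ B[N_G] to the crossed homomorphism with f(ρ) = a = (x − ρσ x)/2 and
-- f(σ) = 0, namely f(ρⁱσˢ) = (1 + ρ + ⋯ + ρⁱ⁻¹) a; it is one because N_G a = 0 and ρσ a = − a.
-- For x = u + v with u ∈ B^Σ, v ∈ B^Σ' one finds a = (ρ − 1) b with σ b = b, so f is principal;
-- conversely a principal f forces x − σ x ∈ (1 − ρ) B ⊆ B^Σ + B^Σ', whence
-- x = (x + σ x)/2 + (x − σ x)/2 ∈ B^Σ + B^Σ'. Finally every crossed homomorphism is
-- cohomologous to one vanishing at σ, which is of the above form.

open import Defs
open import Algebra.Bundles using (AbelianGroup)
open import Data.Nat using (ℕ; zero; suc; _+_; _∸_; _*_; NonZero; _≤_; s≤s)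
import Data.Nat.Properties as ℕ
open import Data.Nat.DivMod
  using (_mod_; _%_; _/_; m≡m%n+[m/n]*n; m%n%n≡m%n; [m+n]%n≡m%n; %-distribˡ-+; m<n⇒m%n≡m)
open import Data.Nat.Divisibility using (_∣_)
open import Data.Fin using (Fin; toℕ) renaming (zero to fz; suc to fs)
import Data.Fin.Properties as Fin
open import Data.Bool using (true; false)
open import Data.Vec using (Vec; []; _∷_; lookup; zipWith; replicate)
open import Data.Product using (_×_; _,_; proj₁; proj₂; ∃-syntax)
open import Function using (_∘_; id)
open import Relation.Binary.PropositionalEquality as ≡ using (_≡_)
open import Relation.Nullary using (¬_)
import Relation.Binary.Reasoning.Setoid as SetoidReasoning
import Algebra.Properties.AbelianGroup as AbelianGroupProperties
import Algebra.Properties.CommutativeSemigroup as CommutativeSemigroupProperties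

module AbelianGroupSolver {c ℓ} (G : AbelianGroup c ℓ) where
  open AbelianGroup G renaming (Carrier to A)
  open AbelianGroupProperties G using (ε⁻¹≈ε; ⁻¹-∙-comm; ⁻¹-involutive)
  open CommutativeSemigroupProperties commutativeSemigroup using (interchange)
  open SetoidReasoning setoid

  infixl 6 _⊕_ _⊖_
  infix 8 ⊝_

  data Expr (n : ℕ) : Set where
    var : Fin n → Expr n
    ∅   : Expr n
    _⊕_ : Expr n → Expr n → Expr n
    ⊝_  : Expr n → Expr n

  _⊖_ : ∀ {n} → Expr n → Expr n → Expr n
  e ⊖ e′ = e ⊕ ⊝ e′

  ⟦_⟧ : ∀ {n} → Expr n → Vec A n → A
  ⟦ var i ⟧  xs = lookup xs i
  ⟦ ∅ ⟧      xs = ε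
  ⟦ e ⊕ e′ ⟧ xs = ⟦ e ⟧ xs ∙ ⟦ e′ ⟧ xs
  ⟦ ⊝ e ⟧    xs = ⟦ e ⟧ xs ⁻¹

  -- A normal form records how often each variable occurs positively and negatively.
  Multiplicities : ℕ → Set
  Multiplicities n = Vec ℕ n

  _+ᵐ_ : ∀ {n} → Multiplicities n → Multiplicities n → Multiplicities n
  _+ᵐ_ = zipWith _+_

  0ᵐ : ∀ {n} → Multiplicities n
  0ᵐ = replicate _ 0

  1ᵐ : ∀ {n} → Fin n → Multiplicities n
  1ᵐ fz     = 1 ∷ 0ᵐ
  1ᵐ (fs i) = 0 ∷ 1ᵐ i

  normalise : ∀ {n} → Expr n → Multiplicities n × Multiplicities n
  normalise (var i)  = 1ᵐ i , 0ᵐ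
  normalise ∅        = 0ᵐ , 0ᵐ
  normalise (e ⊕ e′) = let (p , m) = normalise e; (p′ , m′) = normalise e′ in p +ᵐ p′ , m +ᵐ m′
  normalise (⊝ e)    = let (p , m) = normalise e in m , p

  _×ₙ_ : ℕ → A → A
  zero  ×ₙ x = ε
  suc k ×ₙ x = x ∙ (k ×ₙ x)

  ⟦_⟧ᵐ : ∀ {n} → Multiplicities n → Vec A n → A
  ⟦ [] ⟧ᵐ     []       = ε
  ⟦ k ∷ ks ⟧ᵐ (x ∷ xs) = (k ×ₙ x) ∙ ⟦ ks ⟧ᵐ xs

  ×ₙ-+ : ∀ k l x → (k + l) ×ₙ x ≈ (k ×ₙ x) ∙ (l ×ₙ x)
  ×ₙ-+ zero    l x = sym (identityˡ _)
  ×ₙ-+ (suc k) l x = trans (∙-congˡ (×ₙ-+ k l x)) (sym (assoc _ _ _))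

  ⟦+ᵐ⟧ : ∀ {n} (u v : Multiplicities n) xs → ⟦ u +ᵐ v ⟧ᵐ xs ≈ ⟦ u ⟧ᵐ xs ∙ ⟦ v ⟧ᵐ xs
  ⟦+ᵐ⟧ []      []      []       = sym (identityˡ _)
  ⟦+ᵐ⟧ (k ∷ u) (l ∷ v) (x ∷ xs) =
    trans (∙-cong (×ₙ-+ k l x) (⟦+ᵐ⟧ u v xs)) (interchange _ _ _ _)

  ⟦0ᵐ⟧ : ∀ {n} (xs : Vec A n) → ⟦ 0ᵐ ⟧ᵐ xs ≈ ε
  ⟦0ᵐ⟧ []       = refl
  ⟦0ᵐ⟧ (x ∷ xs) = trans (identityˡ _) (⟦0ᵐ⟧ xs)

  ⟦1ᵐ⟧ : ∀ {n} (i : Fin n) xs → ⟦ 1ᵐ i ⟧ᵐ xs ≈ lookup xs i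
  ⟦1ᵐ⟧ fz     (x ∷ xs) = trans (∙-cong (identityʳ x) (⟦0ᵐ⟧ xs)) (identityʳ x)
  ⟦1ᵐ⟧ (fs i) (x ∷ xs) = trans (identityˡ _) (⟦1ᵐ⟧ i xs)

  ⟦_⟧ⁿ : ∀ {n} → Multiplicities n × Multiplicities n → Vec A n → A
  ⟦ p , m ⟧ⁿ xs = ⟦ p ⟧ᵐ xs ∙ ⟦ m ⟧ᵐ xs ⁻¹

  ⟦0ᵐ⟧⁻¹ : ∀ {n} (xs : Vec A n) → ⟦ 0ᵐ ⟧ᵐ xs ⁻¹ ≈ ε
  ⟦0ᵐ⟧⁻¹ xs = trans (⁻¹-cong (⟦0ᵐ⟧ xs)) ε⁻¹≈ε

  normalise-correct : ∀ {n} (e : Expr n) xs → ⟦ e ⟧ xs ≈ ⟦ normalise e ⟧ⁿ xs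
  normalise-correct (var i) xs =
    sym (trans (∙-cong (⟦1ᵐ⟧ i xs) (⟦0ᵐ⟧⁻¹ xs)) (identityʳ _))
  normalise-correct ∅ xs = sym (trans (∙-congʳ (⟦0ᵐ⟧ xs)) (trans (identityˡ _) (⟦0ᵐ⟧⁻¹ xs)))
  normalise-correct (e ⊕ e′) xs = begin
    ⟦ e ⟧ xs ∙ ⟦ e′ ⟧ xs                 ≈⟨ ∙-cong (normalise-correct e xs) (normalise-correct e′ xs) ⟩
    (⟦ p ⟧ᵐ xs ∙ ⟦ m ⟧ᵐ xs ⁻¹) ∙ (⟦ p′ ⟧ᵐ xs ∙ ⟦ m′ ⟧ᵐ xs ⁻¹)
                                          ≈⟨ interchange _ _ _ _ ⟩
    (⟦ p ⟧ᵐ xs ∙ ⟦ p′ ⟧ᵐ xs) ∙ (⟦ m ⟧ᵐ xs ⁻¹ ∙ ⟦ m′ ⟧ᵐ xs ⁻¹)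
                                          ≈⟨ ∙-cong (sym (⟦+ᵐ⟧ p p′ xs)) (⁻¹-∙-comm _ _) ⟩
    ⟦ p +ᵐ p′ ⟧ᵐ xs ∙ (⟦ m ⟧ᵐ xs ∙ ⟦ m′ ⟧ᵐ xs) ⁻¹
                                          ≈⟨ ∙-congˡ (⁻¹-cong (sym (⟦+ᵐ⟧ m m′ xs))) ⟩
    ⟦ p +ᵐ p′ ⟧ᵐ xs ∙ ⟦ m +ᵐ m′ ⟧ᵐ xs ⁻¹ ∎
    where
    p = proj₁ (normalise e); m = proj₂ (normalise e)
    p′ = proj₁ (normalise e′); m′ = proj₂ (normalise e′)
  normalise-correct (⊝ e) xs = begin
    ⟦ e ⟧ xs ⁻¹                      ≈⟨ ⁻¹-cong (normalise-correct e xs) ⟩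
    (⟦ p ⟧ᵐ xs ∙ ⟦ m ⟧ᵐ xs ⁻¹) ⁻¹    ≈⟨ ⁻¹-∙-comm _ _ ⟨
    ⟦ p ⟧ᵐ xs ⁻¹ ∙ ⟦ m ⟧ᵐ xs ⁻¹ ⁻¹   ≈⟨ comm _ _ ⟩
    ⟦ m ⟧ᵐ xs ⁻¹ ⁻¹ ∙ ⟦ p ⟧ᵐ xs ⁻¹   ≈⟨ ∙-congʳ (⁻¹-involutive _) ⟩
    ⟦ m ⟧ᵐ xs ∙ ⟦ p ⟧ᵐ xs ⁻¹         ∎
    where p = proj₁ (normalise e); m = proj₂ (normalise e)

  ⟦⟧ⁿ-cross : ∀ p m p′ m′ → p ∙ m′ ≈ p′ ∙ m → p ∙ m ⁻¹ ≈ p′ ∙ m′ ⁻¹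
  ⟦⟧ⁿ-cross p m p′ m′ eq = begin
    p ∙ m ⁻¹                          ≈⟨ identityʳ _ ⟨
    (p ∙ m ⁻¹) ∙ ε                    ≈⟨ ∙-congˡ (inverseʳ m′) ⟨
    (p ∙ m ⁻¹) ∙ (m′ ∙ m′ ⁻¹)         ≈⟨ interchange _ _ _ _ ⟩
    (p ∙ m′) ∙ (m ⁻¹ ∙ m′ ⁻¹)         ≈⟨ ∙-congʳ eq ⟩
    (p′ ∙ m) ∙ (m ⁻¹ ∙ m′ ⁻¹)         ≈⟨ assoc _ _ _ ⟩
    p′ ∙ (m ∙ (m ⁻¹ ∙ m′ ⁻¹))         ≈⟨ ∙-congˡ (assoc _ _ _) ⟨
    p′ ∙ ((m ∙ m ⁻¹) ∙ m′ ⁻¹)         ≈⟨ ∙-congˡ (∙-congʳ (inverseʳ m)) ⟩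
    p′ ∙ (ε ∙ m′ ⁻¹)                  ≈⟨ ∙-congˡ (identityˡ _) ⟩
    p′ ∙ m′ ⁻¹                        ∎

  -- Normal forms (p , m) and (p′ , m′) are compared via p + m′ = p′ + m, avoiding subtraction in ℕ.
  solve : ∀ {n} (e e′ : Expr n) →
          proj₁ (normalise e) +ᵐ proj₂ (normalise e′) ≡ proj₁ (normalise e′) +ᵐ proj₂ (normalise e) →
          ∀ xs → ⟦ e ⟧ xs ≈ ⟦ e′ ⟧ xs
  solve e e′ eq xs = begin
    ⟦ e ⟧ xs              ≈⟨ normalise-correct e xs ⟩
    ⟦ normalise e ⟧ⁿ xs   ≈⟨ ⟦⟧ⁿ-cross _ _ _ _ cross ⟩
    ⟦ normalise e′ ⟧ⁿ xs  ≈⟨ normalise-correct e′ xs ⟨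
    ⟦ e′ ⟧ xs             ∎
    where
    cross = trans (sym (⟦+ᵐ⟧ (proj₁ (normalise e)) _ xs))
              (trans (reflexive (≡.cong (λ u → ⟦ u ⟧ᵐ xs) eq)) (⟦+ᵐ⟧ (proj₁ (normalise e′)) _ xs))

  v₀ : ∀ {n} → Expr (1 + n)
  v₀ = var fz
  v₁ : ∀ {n} → Expr (2 + n)
  v₁ = var (fs fz)
  v₂ : ∀ {n} → Expr (3 + n)
  v₂ = var (fs (fs fz))
  v₃ : ∀ {n} → Expr (4 + n)
  v₃ = var (fs (fs (fs fz)))
  v₄ : ∀ {n} → Expr (5 + n)
  v₄ = var (fs (fs (fs (fs fz))))

+-∸-reflect : ∀ {p j} → j ≤ p → p + (suc p ∸ j) ≡ (p ∸ j) + suc p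
+-∸-reflect {p} {j} j≤p = begin
  p + (suc p ∸ j)      ≡⟨ ≡.cong (p +_) (ℕ.+-∸-assoc 1 j≤p) ⟩
  p + suc (p ∸ j)      ≡⟨ ℕ.+-suc p _ ⟩
  suc (p + (p ∸ j))    ≡⟨ ≡.cong suc (ℕ.+-comm p _) ⟩
  suc ((p ∸ j) + p)    ≡⟨ ℕ.+-suc _ p ⟨
  (p ∸ j) + suc p      ∎
  where open ≡.≡-Reasoning

module _ {n : ℕ} .{{_ : NonZero n}} where
  open ≡.≡-Reasoning

  toℕ-mod : ∀ m → toℕ (m mod n) ≡ m % n
  toℕ-mod m = Fin.toℕ-fromℕ< _

  mod-toℕ : ∀ (i : Fin n) → toℕ i mod n ≡ i
  mod-toℕ i = Fin.toℕ-injective (≡.trans (toℕ-mod (toℕ i)) (m<n⇒m%n≡m (Fin.toℕ<n i)))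

  mod-self : n mod n ≡ 0 mod n
  mod-self = Fin.toℕ-injective (begin
    toℕ (n mod n)   ≡⟨ toℕ-mod n ⟩
    n % n           ≡⟨ [m+n]%n≡m%n 0 n ⟩
    0 % n           ≡⟨ toℕ-mod 0 ⟨
    toℕ (0 mod n)   ∎)

  suc-mod : ∀ m → suc m mod n ≡ suc (toℕ (m mod n)) mod n
  suc-mod m = Fin.toℕ-injective (begin
    toℕ (suc m mod n)                  ≡⟨ toℕ-mod (suc m) ⟩
    (1 + m) % n                        ≡⟨ %-distribˡ-+ 1 m n ⟩
    (1 % n + m % n) % n                ≡⟨ ≡.cong (λ r → (1 % n + r) % n) (m%n%n≡m%n m n) ⟨
    (1 % n + m % n % n) % n            ≡⟨ %-distribˡ-+ 1 (m % n) n ⟨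
    (1 + m % n) % n                    ≡⟨ ≡.cong (λ r → (1 + r) % n) (toℕ-mod m) ⟨
    (1 + toℕ (m mod n)) % n            ≡⟨ toℕ-mod (suc (toℕ (m mod n))) ⟨
    toℕ (suc (toℕ (m mod n)) mod n)    ∎)

module Endomorphisms {c ℓ} (B : AbelianGroup c ℓ) where
  open AbelianGroup B renaming (Carrier to A)
  open AbelianGroupProperties B using (⁻¹-∙-comm)
  open CommutativeSemigroupProperties commutativeSemigroup using (interchange)
  open SetoidReasoning setoid
  open AbelianGroupSolver B
  open IsEndo

  module _ {f : A → A} (f-endo : IsEndo B f) where
    endo-ε : f ε ≈ ε
    endo-ε = begin
      f ε                ≈⟨ solve v₀ ((v₀ ⊕ v₀) ⊖ v₀) ≡.refl (f ε ∷ []) ⟩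
      (f ε ∙ f ε) - f ε  ≈⟨ ∙-congʳ (∙-hom f-endo ε ε) ⟨
      f (ε ∙ ε) - f ε    ≈⟨ ∙-congʳ (≈-cong f-endo (identityˡ ε)) ⟩
      f ε - f ε          ≈⟨ inverseʳ _ ⟩
      ε                  ∎

    endo-⁻¹ : ∀ x → f (x ⁻¹) ≈ f x ⁻¹
    endo-⁻¹ x = begin
      f (x ⁻¹)                ≈⟨ solve v₀ ((v₀ ⊕ v₁) ⊖ v₁) ≡.refl (f (x ⁻¹) ∷ f x ∷ []) ⟩
      (f (x ⁻¹) ∙ f x) - f x  ≈⟨ ∙-congʳ (∙-hom f-endo _ _) ⟨
      f (x ⁻¹ ∙ x) - f x      ≈⟨ ∙-congʳ (trans (≈-cong f-endo (inverseˡ x)) endo-ε) ⟩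
      ε - f x                 ≈⟨ identityˡ _ ⟩
      f x ⁻¹                  ∎

    endo-− : ∀ x y → f (x - y) ≈ f x - f y
    endo-− x y = trans (∙-hom f-endo _ _) (∙-congˡ (endo-⁻¹ y))

    endo-difference-⁻¹ : ∀ b → f (b ⁻¹) - b ⁻¹ ≈ b - f b
    endo-difference-⁻¹ b = trans (∙-congʳ (endo-⁻¹ b)) (solve (⊝ v₁ ⊖ ⊝ v₀) (v₀ ⊖ v₁) ≡.refl (b ∷ f b ∷ []))

  ∘-endo : ∀ {f g} → IsEndo B f → IsEndo B g → IsEndo B (f ∘ g)
  ∘-endo f-endo g-endo = record
    { ≈-cong = ≈-cong f-endo ∘ ≈-cong g-endo
    ; ∙-hom  = λ x y → trans (≈-cong f-endo (∙-hom g-endo x y)) (∙-hom f-endo _ _)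
    }

  iter-endo : ∀ {f} → IsEndo B f → ∀ n → IsEndo B (iter n f)
  iter-endo f-endo zero    = record { ≈-cong = id ; ∙-hom = λ _ _ → refl }
  iter-endo f-endo (suc n) = ∘-endo f-endo (iter-endo f-endo n)

  iter-suc : ∀ {f : A → A} n x → iter n f (f x) ≡ f (iter n f x)
  iter-suc zero    x = ≡.refl
  iter-suc {f} (suc n) x = ≡.cong f (iter-suc n x)

  iter-fixed : ∀ {f} → IsEndo B f → ∀ {z} → f z ≈ z → ∀ n → iter n f z ≈ z
  iter-fixed f-endo fixed zero    = refl
  iter-fixed f-endo fixed (suc n) = trans (≈-cong f-endo (iter-fixed f-endo fixed n)) fixed

  iter-natural : ∀ {f f′ g : A → A} → IsEndo B f′ → (∀ z → g (f z) ≈ f′ (g z)) →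
                 ∀ n z → g (iter n f z) ≈ iter n f′ (g z)
  iter-natural f′-endo gf≈f′g zero    z = refl
  iter-natural f′-endo gf≈f′g (suc n) z =
    trans (gf≈f′g _) (≈-cong f′-endo (iter-natural f′-endo gf≈f′g n z))

  1+f-endo : ∀ {f} → IsEndo B f → IsEndo B (λ x → x ∙ f x)
  1+f-endo f-endo = record
    { ≈-cong = λ x≈y → ∙-cong x≈y (≈-cong f-endo x≈y)
    ; ∙-hom  = λ x y → trans (∙-congˡ (∙-hom f-endo x y)) (interchange _ _ _ _)
    }

  1-f-endo : ∀ {f} → IsEndo B f → IsEndo B (λ x → x - f x)
  1-f-endo f-endo = 1+f-endo (∘-endo ⁻¹-endo f-endo)
    where
    ⁻¹-endo : IsEndo B _⁻¹
    ⁻¹-endo = record { ≈-cong = ⁻¹-cong ; ∙-hom = λ x y → sym (⁻¹-∙-comm x y) }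

  orbitSum : (A → A) → ℕ → A → A
  orbitSum f zero    y = ε
  orbitSum f (suc n) y = y ∙ f (orbitSum f n y)

  module _ {f : A → A} (f-endo : IsEndo B f) where
    orbitSum-endo : ∀ n → IsEndo B (orbitSum f n)
    orbitSum-endo n = record { ≈-cong = cong n ; ∙-hom = hom n }
      where
      cong : ∀ n {y y′} → y ≈ y′ → orbitSum f n y ≈ orbitSum f n y′
      cong zero    y≈y′ = refl
      cong (suc n) y≈y′ = ∙-cong y≈y′ (≈-cong f-endo (cong n y≈y′))
      hom : ∀ n y z → orbitSum f n (y ∙ z) ≈ orbitSum f n y ∙ orbitSum f n z
      hom zero    y z = sym (identityˡ ε)
      hom (suc n) y z = trans (∙-congˡ (trans (≈-cong f-endo (hom n y z)) (∙-hom f-endo _ _)))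
                              (interchange _ _ _ _)

    orbitSum-+ : ∀ m n y → orbitSum f (m + n) y ≈ orbitSum f m y ∙ iter m f (orbitSum f n y)
    orbitSum-+ zero    n y = sym (identityˡ _)
    orbitSum-+ (suc m) n y = begin
      y ∙ f (orbitSum f (m + n) y)                              ≈⟨ ∙-congˡ (≈-cong f-endo (orbitSum-+ m n y)) ⟩
      y ∙ f (orbitSum f m y ∙ iter m f (orbitSum f n y))        ≈⟨ ∙-congˡ (∙-hom f-endo _ _) ⟩
      y ∙ (f (orbitSum f m y) ∙ f (iter m f (orbitSum f n y)))  ≈⟨ assoc _ _ _ ⟨
      (y ∙ f (orbitSum f m y)) ∙ f (iter m f (orbitSum f n y))  ∎

    orbitSum-suc : ∀ n y → orbitSum f (suc n) y ≈ orbitSum f n y ∙ iter n f y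
    orbitSum-suc n y = begin
      orbitSum f (suc n) y                   ≡⟨ ≡.cong (λ m → orbitSum f m y) (ℕ.+-comm 1 n) ⟩
      orbitSum f (n + 1) y                   ≈⟨ orbitSum-+ n 1 y ⟩
      orbitSum f n y ∙ iter n f (y ∙ f ε)    ≈⟨ ∙-congˡ (≈-cong (iter-endo f-endo n)
                                                  (trans (∙-congˡ (endo-ε f-endo)) (identityʳ y))) ⟩
      orbitSum f n y ∙ iter n f y            ∎

    orbitSum-telescope : ∀ n y → orbitSum f n (f y - y) ≈ iter n f y - y
    orbitSum-telescope zero    y = sym (inverseʳ y)
    orbitSum-telescope (suc n) y = begin
      (f y - y) ∙ f (orbitSum f n (f y - y))  ≈⟨ ∙-congˡ (≈-cong f-endo (orbitSum-telescope n y)) ⟩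
      (f y - y) ∙ f (iter n f y - y)          ≈⟨ ∙-congˡ (endo-− f-endo _ _) ⟩
      (f y - y) ∙ (f (iter n f y) - f y)      ≈⟨ solve ((v₀ ⊖ v₁) ⊕ (v₂ ⊖ v₀)) (v₂ ⊖ v₁) ≡.refl
                                                   (f y ∷ y ∷ f (iter n f y) ∷ []) ⟩
      f (iter n f y) - y                      ∎

    orbitSum-periodic : ∀ {q a} → orbitSum f q a ≈ ε → ∀ n m → orbitSum f (m + n * q) a ≈ orbitSum f m a
    orbitSum-periodic {q} {a} Σa≈ε zero m = reflexive (≡.cong (λ n → orbitSum f n a) (ℕ.+-identityʳ m))
    orbitSum-periodic {q} {a} Σa≈ε (suc n) m = begin
      orbitSum f (m + (q + n * q)) a      ≡⟨ ≡.cong (λ n → orbitSum f n a) (ℕ.+-assoc m q (n * q)) ⟨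
      orbitSum f (m + q + n * q) a        ≈⟨ orbitSum-periodic Σa≈ε n (m + q) ⟩
      orbitSum f (m + q) a                ≈⟨ orbitSum-+ m q a ⟩
      orbitSum f m a ∙ iter m f (orbitSum f q a)
                                          ≈⟨ ∙-congˡ (trans (≈-cong (iter-endo f-endo m) Σa≈ε)
                                                            (endo-ε (iter-endo f-endo m))) ⟩
      orbitSum f m a ∙ ε                  ≈⟨ identityʳ _ ⟩
      orbitSum f m a                      ∎

  orbitSum-natural : ∀ {f f′ g : A → A} → IsEndo B g → IsEndo B f′ → (∀ z → g (f z) ≈ f′ (g z)) →
                     ∀ n y → g (orbitSum f n y) ≈ orbitSum f′ n (g y)
  orbitSum-natural g-endo f′-endo gf≈f′g zero    y = endo-ε g-endo
  orbitSum-natural g-endo f′-endo gf≈f′g (suc n) y = trans (∙-hom g-endo _ _)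
    (∙-congˡ (trans (gf≈f′g _) (≈-cong f′-endo (orbitSum-natural g-endo f′-endo gf≈f′g n y))))

  orbitSum-reverse : ∀ {f g} → IsEndo B f → IsEndo B g → (∀ z → g (f z) ≈ z) →
                     ∀ n y → orbitSum g (suc n) y ≈ iter n g (orbitSum f (suc n) y)
  orbitSum-reverse f-endo g-endo gf≈id zero y =
    trans (∙-congˡ (endo-ε g-endo)) (sym (∙-congˡ (endo-ε f-endo)))
  orbitSum-reverse {f} {g} f-endo g-endo gf≈id (suc n) y = begin
    orbitSum g (2 + n) y                          ≈⟨ orbitSum-suc g-endo (suc n) y ⟩
    orbitSum g (suc n) y ∙ iter (suc n) g y       ≈⟨ ∙-congʳ (orbitSum-reverse f-endo g-endo gf≈id n y) ⟩
    iter n g (Σf (suc n)) ∙ iter (suc n) g y      ≈⟨ ∙-congʳ (≈-cong (iter-endo g-endo n) (gf≈id _)) ⟨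
    iter n g (g (f (Σf (suc n)))) ∙ iter (suc n) g y
                                                  ≡⟨ ≡.cong (_∙ iter (suc n) g y) (iter-suc n _) ⟩
    iter (suc n) g (f (Σf (suc n))) ∙ iter (suc n) g y
                                                  ≈⟨ comm _ _ ⟩
    iter (suc n) g y ∙ iter (suc n) g (f (Σf (suc n)))
                                                  ≈⟨ ∙-hom (iter-endo g-endo (suc n)) _ _ ⟨
    iter (suc n) g (Σf (2 + n))                   ∎
    where
    Σf : ℕ → A
    Σf m = orbitSum f m y

  sumFin-endo : ∀ {f} → IsEndo B f → ∀ n (F : Fin n → A) → sumFin B n (f ∘ F) ≈ f (sumFin B n F)
  sumFin-endo f-endo zero    F = sym (endo-ε f-endo)
  sumFin-endo f-endo (suc n) F = trans (∙-congˡ (sumFin-endo f-endo n (F ∘ fs))) (sym (∙-hom f-endo _ _))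

  sumFin-iter : ∀ {f} → IsEndo B f → ∀ n x → sumFin B n (λ i → iter (toℕ i) f x) ≈ orbitSum f n x
  sumFin-iter f-endo zero    x = refl
  sumFin-iter f-endo (suc n) x =
    ∙-congˡ (trans (sumFin-endo f-endo n _) (≈-cong f-endo (sumFin-iter f-endo n x)))

  sumFin-ε : ∀ n F → (∀ i → F i ≈ ε) → sumFin B n F ≈ ε
  sumFin-ε zero    F F≈ε = refl
  sumFin-ε (suc n) F F≈ε = trans (∙-cong (F≈ε fz) (sumFin-ε n (F ∘ fs) (F≈ε ∘ fs))) (identityʳ ε)

  sumFin-closed : ∀ {p} (P : A → Set p) → (∀ {x y} → x ≈ y → P x → P y) → P ε →
                  (∀ {x y} → P x → P y → P (x ∙ y)) → ∀ n F → (∀ i → P (F i)) → P (sumFin B n F)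
  sumFin-closed P resp Pε P∙ zero    F PF = Pε
  sumFin-closed P resp Pε P∙ (suc n) F PF = P∙ (PF fz) (sumFin-closed P resp Pε P∙ n (F ∘ fs) (PF ∘ fs))

module Halving {c ℓ} (B : AbelianGroup c ℓ) (two-divisible : UniquelyTwoDivisible B) where
  open AbelianGroup B renaming (Carrier to A)
  open AbelianGroupProperties B using (⁻¹-anti-homo‿-)
  open SetoidReasoning setoid
  open AbelianGroupSolver B
  open Endomorphisms B using (endo-−; endo-⁻¹)
  open CommutativeSemigroupProperties commutativeSemigroup using (interchange)
  open IsEndo

  half : A → A
  half y = proj₁ (proj₁ two-divisible y)

  half-∙-half : ∀ y → half y ∙ half y ≈ y
  half-∙-half y = proj₂ (proj₁ two-divisible y)

  double-injective : ∀ x y → x ∙ x ≈ y ∙ y → x ≈ y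
  double-injective = proj₂ two-divisible

  half-unique : ∀ {x y} → x ∙ x ≈ y → x ≈ half y
  half-unique {x} {y} x+x≈y = double-injective _ _ (trans x+x≈y (sym (half-∙-half y)))

  half-endo : IsEndo B half
  half-endo = record
    { ≈-cong = λ {y} y≈y′ → half-unique (trans (half-∙-half y) y≈y′)
    ; ∙-hom  = λ x y → sym (half-unique (trans (interchange _ _ _ _) (∙-cong (half-∙-half x) (half-∙-half y))))
    }

  half-natural : ∀ {f} → IsEndo B f → ∀ y → half (f y) ≈ f (half y)
  half-natural f-endo y = sym (half-unique (trans (sym (∙-hom f-endo _ _)) (≈-cong f-endo (half-∙-half y))))

  half-split : ∀ x y → half (x ∙ y) ∙ half (x - y) ≈ x
  half-split x y = double-injective _ _ (begin
    (half (x ∙ y) ∙ half (x - y)) ∙ (half (x ∙ y) ∙ half (x - y))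
                                       ≈⟨ interchange _ _ _ _ ⟩
    (half (x ∙ y) ∙ half (x ∙ y)) ∙ (half (x - y) ∙ half (x - y))
                                       ≈⟨ ∙-cong (half-∙-half _) (half-∙-half _) ⟩
    (x ∙ y) ∙ (x - y)                  ≈⟨ solve ((v₀ ⊕ v₁) ⊕ (v₀ ⊖ v₁)) (v₀ ⊕ v₀) ≡.refl (x ∷ y ∷ []) ⟩
    x ∙ x                              ∎)

  half-antiInvariant : ∀ {τ} → IsEndo B τ → (∀ z → τ (τ z) ≈ z) →
                       ∀ x → τ (half (x - τ x)) ≈ half (x - τ x) ⁻¹
  half-antiInvariant {τ} τ-endo τ² x = begin
    τ (half (x - τ x))      ≈⟨ half-natural τ-endo _ ⟨
    half (τ (x - τ x))      ≈⟨ ≈-cong half-endo (trans (endo-− τ-endo _ _) (∙-congˡ (⁻¹-cong (τ² x)))) ⟩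
    half (τ x - x)          ≈⟨ ≈-cong half-endo (⁻¹-anti-homo‿- x (τ x)) ⟨
    half ((x - τ x) ⁻¹)     ≈⟨ endo-⁻¹ half-endo _ ⟩
    half (x - τ x) ⁻¹       ∎

module DihedralModule {c ℓ} (B : AbelianGroup c ℓ) (k : ℕ) (M : DModule B (suc (suc k))) where
  open AbelianGroup B renaming (Carrier to A)
  open SetoidReasoning setoid
  open AbelianGroupSolver B
  open Endomorphisms B
  open DModule M public
  open IsEndo

  q : ℕ
  q = suc (suc k)

  ρ⁻¹ : A → A
  ρ⁻¹ = iter (suc k) ρ

  ρ⁻¹-endo : IsEndo B ρ⁻¹
  ρ⁻¹-endo = iter-endo ρ-endo (suc k)

  ρρ⁻¹ : ∀ z → ρ (ρ⁻¹ z) ≈ z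
  ρρ⁻¹ = ρ^q

  ρ⁻¹ρ : ∀ z → ρ⁻¹ (ρ z) ≈ z
  ρ⁻¹ρ z = trans (reflexive (iter-suc {ρ} (suc k) z)) (ρ^q z)

  σ-ρⁿ : ∀ n z → σ (iter n ρ z) ≈ iter n ρ⁻¹ (σ z)
  σ-ρⁿ = iter-natural ρ⁻¹-endo σρ

  σρ-fixed⇒σ≈ρ : ∀ {v} → σ (ρ v) ≈ v → σ v ≈ ρ v
  σρ-fixed⇒σ≈ρ {v} σρv≈v = trans (≈-cong σ-endo (sym σρv≈v)) (σ² (ρ v))

  N : A → A
  N = orbitSum ρ q

  N-endo : IsEndo B N
  N-endo = orbitSum-endo ρ-endo q

  NG≈N : ∀ x → NG B M x ≈ N x
  NG≈N = sumFin-iter ρ-endo q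

  ρ-N : ∀ x → ρ (N x) ≈ N x
  ρ-N x = begin
    ρ (N x)                ≈⟨ solve v₀ ((v₁ ⊕ v₀) ⊖ v₁) ≡.refl (ρ (N x) ∷ x ∷ []) ⟩
    orbitSum ρ (suc q) x - x  ≈⟨ ∙-congʳ (orbitSum-suc ρ-endo q x) ⟩
    (N x ∙ iter q ρ x) - x ≈⟨ ∙-congʳ (∙-congˡ (ρ^q x)) ⟩
    (N x ∙ x) - x          ≈⟨ solve ((v₀ ⊕ v₁) ⊖ v₁) v₀ ≡.refl (N x ∷ x ∷ []) ⟩
    N x                    ∎

  N-ρ : ∀ x → N (ρ x) ≈ N x
  N-ρ x = trans (sym (orbitSum-natural ρ-endo ρ-endo (λ _ → refl) q x)) (ρ-N x)

  N-reverse : ∀ y → orbitSum ρ⁻¹ q y ≈ N y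
  N-reverse y = trans (orbitSum-reverse ρ-endo ρ⁻¹-endo ρ⁻¹ρ (suc k) y)
                      (iter-fixed ρ⁻¹-endo ρ⁻¹-N (suc k))
    where
    ρ⁻¹-N : ρ⁻¹ (N y) ≈ N y
    ρ⁻¹-N = trans (≈-cong ρ⁻¹-endo (sym (ρ-N y))) (ρ⁻¹ρ (N y))

  σ-N : ∀ x → σ (N x) ≈ N (σ x)
  σ-N x = trans (orbitSum-natural σ-endo ρ⁻¹-endo σρ q x) (N-reverse (σ x))

  τ : A → A
  τ = ρ ∘ σ

  τ-endo : IsEndo B τ
  τ-endo = ∘-endo ρ-endo σ-endo

  τ-involutive : ∀ z → τ (τ z) ≈ z
  τ-involutive z = trans (≈-cong ρ-endo (σρ (σ z))) (trans (ρρ⁻¹ _) (σ² z))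

  σρ-involutive : ∀ z → σ (ρ (σ (ρ z))) ≈ z
  σρ-involutive z = trans (σρ _) (trans (≈-cong ρ⁻¹-endo (σ² _)) (ρ⁻¹ρ z))

  N-τ : ∀ x → N (τ x) ≈ σ (N x)
  N-τ x = trans (N-ρ (σ x)) (sym (σ-N x))

  1+σ 1-σ : A → A
  1+σ x = x ∙ σ x
  1-σ x = x - σ x

  1+σ-endo : IsEndo B 1+σ
  1+σ-endo = 1+f-endo σ-endo

  σ-1+σ : ∀ x → σ (1+σ x) ≈ 1+σ x
  σ-1+σ x = trans (∙-hom σ-endo _ _) (trans (∙-congˡ (σ² x)) (comm _ _))

  KerNG-− : ∀ {x y} → KerNG B M x → KerNG B M y → KerNG B M (x - y)
  KerNG-− {x} {y} NGx≈ε NGy≈ε = begin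
    NG B M (x - y)           ≈⟨ NG≈N (x - y) ⟩
    N (x - y)                ≈⟨ endo-− N-endo x y ⟩
    N x - N y                ≈⟨ ∙-cong (trans (sym (NG≈N x)) NGx≈ε) (⁻¹-cong (trans (sym (NG≈N y)) NGy≈ε)) ⟩
    ε - ε                    ≈⟨ inverseʳ ε ⟩
    ε                        ∎

  act-endo : ∀ g → IsEndo B (act B M g)
  act-endo (i , false) = iter-endo ρ-endo (toℕ i)
  act-endo (i , true)  = ∘-endo (iter-endo ρ-endo (toℕ i)) σ-endo

  act-ε-difference : ∀ g → act B M g ε - ε ≈ ε
  act-ε-difference g = trans (∙-congʳ (endo-ε (act-endo g))) (inverseʳ ε)

module TateCohomology {c ℓ} (B : AbelianGroup c ℓ) (k : ℕ) (M : DModule B (suc (suc k)))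
                      (two-divisible : UniquelyTwoDivisible B) where
  open AbelianGroup B renaming (Carrier to A)
  open SetoidReasoning setoid
  open AbelianGroupSolver B
  open Endomorphisms B
  open Halving B two-divisible
  open DihedralModule B k M
  open IsEndo

  IG : A → Set _
  IG = IGB B M

  ID : A → Set _
  ID = IDB B M

  IG-resp : ∀ {x y} → x ≈ y → IG x → IG y
  IG-resp x≈y (b , x≈b-ρb) = b , trans (sym x≈y) x≈b-ρb

  IG-ε : IG ε
  IG-ε = ε , sym (trans (∙-congˡ (⁻¹-cong (endo-ε ρ-endo))) (inverseʳ ε))

  IG-∙ : ∀ {x y} → IG x → IG y → IG (x ∙ y)
  IG-∙ {x} {y} (b , x≈) (b′ , y≈) = b ∙ b′ , (begin
    x ∙ y                        ≈⟨ ∙-cong x≈ y≈ ⟩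
    (b - ρ b) ∙ (b′ - ρ b′)      ≈⟨ ∙-hom (1-f-endo ρ-endo) b b′ ⟨
    (b ∙ b′) - ρ (b ∙ b′)        ∎)

  IG-⁻¹ : ∀ {x} → IG x → IG (x ⁻¹)
  IG-⁻¹ {x} (b , x≈) = b ⁻¹ , trans (⁻¹-cong x≈) (sym (endo-⁻¹ (1-f-endo ρ-endo) b))

  IG-ρ-difference : ∀ w → IG (ρ w - w)
  IG-ρ-difference w = IG-resp (solve (⊝ (v₀ ⊖ v₁)) (v₁ ⊖ v₀) ≡.refl (w ∷ ρ w ∷ [])) (IG-⁻¹ (w , refl))

  IG-iter-difference : ∀ {f} → (∀ w → IG (f w - w)) → ∀ n w → IG (iter n f w - w)
  IG-iter-difference IG-f zero    w = IG-resp (sym (inverseʳ w)) IG-ε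
  IG-iter-difference {f} IG-f (suc n) w = IG-resp
    (solve ((v₀ ⊖ v₁) ⊕ (v₁ ⊖ v₂)) (v₀ ⊖ v₂) ≡.refl (f (iter n f w) ∷ iter n f w ∷ w ∷ []))
    (IG-∙ (IG-f (iter n f w)) (IG-iter-difference IG-f n w))

  IG-ρⁿ-difference : ∀ n w → IG (iter n ρ w - w)
  IG-ρⁿ-difference = IG-iter-difference IG-ρ-difference

  IG-ρ⁻ⁿ-difference : ∀ n w → IG (iter n ρ⁻¹ w - w)
  IG-ρ⁻ⁿ-difference = IG-iter-difference (IG-ρⁿ-difference (suc k))

  IG-halve : ∀ {z} → IG (z ∙ z) → IG z
  IG-halve (b , z+z≈) = half b , trans (half-unique z+z≈) (half-natural (1-f-endo ρ-endo) b)

  ID-resp : ∀ {x y} → x ≈ y → ID x → ID y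
  ID-resp x≈y (b , x≈) = b , trans (sym x≈y) x≈

  concentratedAtρ concentratedAtσ : A → Dih q → A
  concentratedAtρ c (fs fz , false) = c
  concentratedAtρ c _               = ε
  concentratedAtσ c (fz , true) = c
  concentratedAtσ c _           = ε

  sumFin-act-ε : ∀ n (g : Fin n → Dih q) → sumFin B n (λ i → act B M (g i) ε - ε) ≈ ε
  sumFin-act-ε n g = sumFin-ε n _ (act-ε-difference ∘ g)

  ID-ρ-difference : ∀ c → ID (ρ c - c)
  ID-ρ-difference c = concentratedAtρ c , sym (begin
    ((act B M (fz , false) ε - ε) ∙ ((ρ c - c) ∙ sumFin B k (λ i → act B M (fs (fs i) , false) ε - ε)))
      ∙ sumFin B q (λ i → act B M (i , true) ε - ε)
                                  ≈⟨ ∙-cong (∙-cong (act-ε-difference (fz , false))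
                                                    (∙-congˡ (sumFin-act-ε k (λ i → fs (fs i) , false))))
                                            (sumFin-act-ε q (_, true)) ⟩
    (ε ∙ ((ρ c - c) ∙ ε)) ∙ ε     ≈⟨ trans (identityʳ _) (trans (identityˡ _) (identityʳ _)) ⟩
    ρ c - c                       ∎)

  ID-σ-difference : ∀ c → ID (σ c - c)
  ID-σ-difference c = concentratedAtσ c , sym (begin
    sumFin B q (λ i → act B M (i , false) ε - ε)
      ∙ ((σ c - c) ∙ sumFin B (suc k) (λ i → act B M (fs i , true) ε - ε))
                                  ≈⟨ ∙-cong (sumFin-act-ε q (_, false))
                                            (∙-congˡ (sumFin-act-ε (suc k) (λ i → fs i , true))) ⟩
    ε ∙ ((σ c - c) ∙ ε)           ≈⟨ trans (identityˡ _) (identityʳ _) ⟩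
    σ c - c                       ∎)

  IG⇒ID : ∀ {z} → IG z → ID z
  IG⇒ID {z} (b , z≈b-ρb) = ID-resp (begin
    ρ (b ⁻¹) - b ⁻¹   ≈⟨ endo-difference-⁻¹ ρ-endo b ⟩
    b - ρ b           ≈⟨ z≈b-ρb ⟨
    z                 ∎) (ID-ρ-difference (b ⁻¹))

  IG-1+σ-act-difference : ∀ g b → IG (1+σ (act B M g b - b))
  IG-1+σ-act-difference (i , false) b = IG-resp (begin
    (ρⁱ b - b) ∙ (iter (toℕ i) ρ⁻¹ (σ b) - σ b)
                                      ≈⟨ ∙-congˡ (∙-congʳ (σ-ρⁿ (toℕ i) b)) ⟨
    (ρⁱ b - b) ∙ (σ (ρⁱ b) - σ b)     ≈⟨ ∙-congˡ (endo-− σ-endo _ _) ⟨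
    1+σ (ρⁱ b - b)                    ∎)
    (IG-∙ (IG-ρⁿ-difference (toℕ i) b) (IG-ρ⁻ⁿ-difference (toℕ i) (σ b)))
    where
    ρⁱ : A → A
    ρⁱ = iter (toℕ i) ρ
  IG-1+σ-act-difference (i , true) b = IG-resp (begin
    (ρⁱ (σ b) - σ b) ∙ (iter (toℕ i) ρ⁻¹ b - b)
                                          ≈⟨ solve ((v₀ ⊖ v₁) ⊕ (v₂ ⊖ v₃)) ((v₀ ⊖ v₃) ⊕ (v₂ ⊖ v₁)) ≡.refl
                                               (ρⁱ (σ b) ∷ σ b ∷ iter (toℕ i) ρ⁻¹ b ∷ b ∷ []) ⟩
    (ρⁱ (σ b) - b) ∙ (iter (toℕ i) ρ⁻¹ b - σ b)
                                          ≈⟨ ∙-congˡ (∙-congʳ (trans (≈-cong (iter-endo ρ⁻¹-endo (toℕ i)) (sym (σ² b)))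
                                                                     (sym (σ-ρⁿ (toℕ i) (σ b))))) ⟩
    (ρⁱ (σ b) - b) ∙ (σ (ρⁱ (σ b)) - σ b) ≈⟨ ∙-congˡ (endo-− σ-endo _ _) ⟨
    1+σ (ρⁱ (σ b) - b)                    ∎)
    (IG-∙ (IG-ρⁿ-difference (toℕ i) (σ b)) (IG-ρ⁻ⁿ-difference (toℕ i) b))
    where
    ρⁱ : A → A
    ρⁱ = iter (toℕ i) ρ

  ID⇒IG-1+σ : ∀ {x} → ID x → IG (1+σ x)
  ID⇒IG-1+σ {x} (b , x≈) = IG-resp (≈-cong 1+σ-endo (sym x≈)) (IG-1+σ-∙
    (IG-1+σ-sumFin q _ (λ i → IG-1+σ-act-difference (i , false) (b (i , false))))
    (IG-1+σ-sumFin q _ (λ i → IG-1+σ-act-difference (i , true) (b (i , true)))))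
    where
    IG-1+σ-∙ : ∀ {x y} → IG (1+σ x) → IG (1+σ y) → IG (1+σ (x ∙ y))
    IG-1+σ-∙ p p′ = IG-resp (sym (∙-hom 1+σ-endo _ _)) (IG-∙ p p′)
    IG-1+σ-sumFin : ∀ n F → (∀ i → IG (1+σ (F i))) → IG (1+σ (sumFin B n F))
    IG-1+σ-sumFin = sumFin-closed (IG ∘ 1+σ) (IG-resp ∘ ≈-cong 1+σ-endo)
                      (IG-resp (sym (endo-ε 1+σ-endo)) IG-ε) IG-1+σ-∙

  InvSum⇒IG-1-σ : ∀ {x} → InvSum B M x → IG (1-σ x)
  InvSum⇒IG-1-σ {x} (u , v , σu≈u , σρv≈v , x≈u+v) = IG-resp (begin
    v - ρ v                  ≈⟨ solve (v₀ ⊖ v₁) ((v₂ ⊕ v₀) ⊖ (v₂ ⊕ v₁)) ≡.refl (v ∷ ρ v ∷ u ∷ []) ⟩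
    (u ∙ v) - (u ∙ ρ v)      ≈⟨ ∙-congˡ (⁻¹-cong (∙-cong σu≈u (σρ-fixed⇒σ≈ρ σρv≈v))) ⟨
    (u ∙ v) - (σ u ∙ σ v)    ≈⟨ ∙-congˡ (⁻¹-cong (∙-hom σ-endo u v)) ⟨
    1-σ (u ∙ v)              ≈⟨ ≈-cong (1-f-endo σ-endo) x≈u+v ⟨
    1-σ x                    ∎) (v , refl)

  InvSum-ID-difference⇒IG : ∀ {x y} → InvSum B M x → InvSum B M y → ID (x - y) → IG (x - y)
  InvSum-ID-difference⇒IG {x} {y} x-inv y-inv d = IG-halve (IG-resp 1+σ∙1-σ
    (IG-∙ (ID⇒IG-1+σ d) (IG-resp 1-σ-difference (IG-∙ (InvSum⇒IG-1-σ x-inv) (IG-⁻¹ (InvSum⇒IG-1-σ y-inv))))))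
    where
    z : A
    z = x - y
    1-σ-difference : 1-σ x - 1-σ y ≈ 1-σ z
    1-σ-difference = sym (endo-− (1-f-endo σ-endo) x y)
    1+σ∙1-σ : 1+σ z ∙ 1-σ z ≈ z ∙ z
    1+σ∙1-σ = solve ((v₀ ⊕ v₁) ⊕ (v₀ ⊖ v₁)) (v₀ ⊕ v₀) ≡.refl (z ∷ σ z ∷ [])

  KerNG⇒KerND : ∀ {x} → KerNG B M x → KerND B M x
  KerNG⇒KerND {x} NGx≈ε = begin
    NG B M x ∙ NG B M (σ x)   ≈⟨ ∙-cong NGx≈ε (NG≈N (σ x)) ⟩
    ε ∙ N (σ x)               ≈⟨ ∙-congˡ (σ-N x) ⟨
    ε ∙ σ (N x)               ≈⟨ ∙-congˡ (≈-cong σ-endo (trans (sym (NG≈N x)) NGx≈ε)) ⟩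
    ε ∙ σ ε                   ≈⟨ trans (identityˡ _) (endo-ε σ-endo) ⟩
    ε                         ∎

  KerND⇒Mem₁-representative : ∀ {y} → KerND B M y → ∃[ x ] (Mem₁ B M x × ID (x - y))
  KerND⇒Mem₁-representative {y} NDy≈ε =
    x , (NGx≈ε , x , ε , σx≈x , σρε≈ε , sym (identityʳ x)) , ID-resp x-y≈ (ID-σ-difference (half y))
    where
    x : A
    x = half (1+σ y)
    σx≈x : σ x ≈ x
    σx≈x = trans (sym (half-natural σ-endo _)) (≈-cong half-endo (σ-1+σ y))
    σρε≈ε : σ (ρ ε) ≈ ε
    σρε≈ε = trans (≈-cong σ-endo (endo-ε ρ-endo)) (endo-ε σ-endo)
    NGx≈ε : KerNG B M x
    NGx≈ε = begin
      NG B M x                 ≈⟨ NG≈N x ⟩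
      N (half (1+σ y))         ≈⟨ half-natural N-endo _ ⟨
      half (N (1+σ y))         ≈⟨ ≈-cong half-endo (trans (∙-hom N-endo _ _) (sym (∙-cong (NG≈N y) (NG≈N (σ y))))) ⟩
      half (NG B M y ∙ NG B M (σ y)) ≈⟨ ≈-cong half-endo NDy≈ε ⟩
      half ε                   ≈⟨ endo-ε half-endo ⟩
      ε                        ∎
    x-y≈ : σ (half y) - half y ≈ x - y
    x-y≈ = begin
      σ (half y) - half y
        ≈⟨ solve (v₁ ⊖ v₀) ((v₀ ⊕ v₁) ⊖ (v₀ ⊕ v₀)) ≡.refl (half y ∷ σ (half y) ∷ []) ⟩
      (half y ∙ σ (half y)) - (half y ∙ half y)
        ≈⟨ ∙-cong (∙-congˡ (sym (half-natural σ-endo y))) (⁻¹-cong (half-∙-half y)) ⟩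
      (half y ∙ half (σ y)) - y
        ≈⟨ ∙-congʳ (∙-hom half-endo y (σ y)) ⟨
      x - y ∎

  Quot₁≅TateHm1 : Quot₁ B M ≅ TateHm1 B M
  Quot₁≅TateHm1 = record
    { to   = id
    ; mem  = KerNG⇒KerND ∘ proj₁
    ; cong = λ _ _ → IG⇒ID
    ; hom  = λ _ _ → IG⇒ID (IG-resp (sym (inverseʳ _)) IG-ε)
    ; inj  = λ (_ , x-inv) (_ , y-inv) → InvSum-ID-difference⇒IG x-inv y-inv
    ; surj = KerND⇒Mem₁-representative
    }

module FirstCohomology {c ℓ} (B : AbelianGroup c ℓ) (k : ℕ) (M : DModule B (suc (suc k)))
                       (two-divisible : UniquelyTwoDivisible B) where
  open AbelianGroup B renaming (Carrier to A)
  open AbelianGroupProperties B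
    using (inverseˡ-unique; inverseʳ-unique; identityˡ-unique; x≈y⇒x∙y⁻¹≈ε; ⁻¹-involutive)
  open SetoidReasoning setoid
  open AbelianGroupSolver B
  open Endomorphisms B
  open Halving B two-divisible
  open DihedralModule B k M
  open IsEndo

  -- The crossed homomorphism with f(ρ) = a and f(σ) = 0, provided it exists.
  cocycle : A → Dih q → A
  cocycle a (i , _) = orbitSum ρ (toℕ i) a

  module _ {a : A} (Na≈ε : N a ≈ ε) where
    orbitSum-mod : ∀ m → orbitSum ρ (toℕ (m mod q)) a ≈ orbitSum ρ m a
    orbitSum-mod m = begin
      orbitSum ρ (toℕ (m mod q)) a        ≡⟨ ≡.cong (λ n → orbitSum ρ n a) (toℕ-mod m) ⟩
      orbitSum ρ (m % q) a                ≈⟨ orbitSum-periodic ρ-endo Na≈ε (m / q) (m % q) ⟨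
      orbitSum ρ (m % q + m / q * q) a    ≡⟨ ≡.cong (λ n → orbitSum ρ n a) (m≡m%n+[m/n]*n m q) ⟨
      orbitSum ρ m a                      ∎

    orbitSum-pred-q : orbitSum ρ (suc k) a ≈ ρ⁻¹ a ⁻¹
    orbitSum-pred-q = inverseˡ-unique _ _ (trans (sym (orbitSum-suc ρ-endo (suc k) a)) Na≈ε)

    module _ (τa≈a⁻¹ : τ a ≈ a ⁻¹) where
      σa≈ : σ a ≈ orbitSum ρ (suc k) a
      σa≈ = begin
        σ a              ≈⟨ ρ⁻¹ρ (σ a) ⟨
        ρ⁻¹ (τ a)        ≈⟨ ≈-cong ρ⁻¹-endo τa≈a⁻¹ ⟩
        ρ⁻¹ (a ⁻¹)       ≈⟨ endo-⁻¹ ρ⁻¹-endo a ⟩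
        ρ⁻¹ a ⁻¹         ≈⟨ orbitSum-pred-q ⟨
        orbitSum ρ (suc k) a ∎

      σ-orbitSum : ∀ j → j ≤ q → σ (orbitSum ρ j a) ≈ orbitSum ρ (q ∸ j) a
      σ-orbitSum zero    _         = trans (endo-ε σ-endo) (sym Na≈ε)
      σ-orbitSum (suc j) (s≤s j≤) = begin
        σ (a ∙ ρ (orbitSum ρ j a))                 ≈⟨ ∙-hom σ-endo _ _ ⟩
        σ a ∙ σ (ρ (orbitSum ρ j a))               ≈⟨ ∙-cong σa≈ (σρ _) ⟩
        orbitSum ρ (suc k) a ∙ ρ⁻¹ (σ (orbitSum ρ j a))
                                                   ≈⟨ ∙-congˡ (≈-cong ρ⁻¹-endo (σ-orbitSum j (ℕ.m≤n⇒m≤1+n j≤))) ⟩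
        orbitSum ρ (suc k) a ∙ ρ⁻¹ (orbitSum ρ (q ∸ j) a)
                                                   ≈⟨ orbitSum-+ ρ-endo (suc k) (q ∸ j) a ⟨
        orbitSum ρ (suc k + (q ∸ j)) a             ≡⟨ ≡.cong (λ n → orbitSum ρ n a) (+-∸-reflect j≤) ⟩
        orbitSum ρ ((suc k ∸ j) + q) a             ≡⟨ ≡.cong (λ n → orbitSum ρ (suc k ∸ j + n) a)
                                                                (ℕ.*-identityˡ q) ⟨
        orbitSum ρ ((suc k ∸ j) + 1 * q) a         ≈⟨ orbitSum-periodic ρ-endo Na≈ε 1 (suc k ∸ j) ⟩
        orbitSum ρ (suc k ∸ j) a                   ∎

      cocycle-crossed : IsCrossedHom B M (cocycle a)
      cocycle-crossed (i , false) (j , _) = begin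
        orbitSum ρ (toℕ ((toℕ i + toℕ j) mod q)) a   ≈⟨ orbitSum-mod (toℕ i + toℕ j) ⟩
        orbitSum ρ (toℕ i + toℕ j) a                 ≈⟨ orbitSum-+ ρ-endo (toℕ i) (toℕ j) a ⟩
        orbitSum ρ (toℕ i) a ∙ iter (toℕ i) ρ (orbitSum ρ (toℕ j) a) ∎
      cocycle-crossed (i , true) (j , _) = begin
        orbitSum ρ (toℕ ((toℕ i + (q ∸ toℕ j)) mod q)) a  ≈⟨ orbitSum-mod (toℕ i + (q ∸ toℕ j)) ⟩
        orbitSum ρ (toℕ i + (q ∸ toℕ j)) a                ≈⟨ orbitSum-+ ρ-endo (toℕ i) _ a ⟩
        orbitSum ρ (toℕ i) a ∙ iter (toℕ i) ρ (orbitSum ρ (q ∸ toℕ j) a)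
                                                          ≈⟨ ∙-congˡ (≈-cong (iter-endo ρ-endo (toℕ i))
                                                               (σ-orbitSum (toℕ j) (ℕ.<⇒≤ (Fin.toℕ<n j)))) ⟨
        orbitSum ρ (toℕ i) a ∙ iter (toℕ i) ρ (σ (orbitSum ρ (toℕ j) a)) ∎

  oddPart : A → A
  oddPart x = half (x - τ x)

  oddPart-endo : IsEndo B oddPart
  oddPart-endo = ∘-endo half-endo (1-f-endo τ-endo)

  N-oddPart : ∀ {x} → N x ≈ ε → N (oddPart x) ≈ ε
  N-oddPart {x} Nx≈ε = begin
    N (half (x - τ x))     ≈⟨ half-natural N-endo _ ⟨
    half (N (x - τ x))     ≈⟨ ≈-cong half-endo (trans (endo-− N-endo _ _) (∙-congˡ (⁻¹-cong (N-τ x)))) ⟩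
    half (N x - σ (N x))   ≈⟨ ≈-cong half-endo (≈-cong (1-f-endo σ-endo) Nx≈ε) ⟩
    half (ε - σ ε)         ≈⟨ endo-ε (∘-endo half-endo (1-f-endo σ-endo)) ⟩
    ε                      ∎

  cocycle-oddPart-crossed : ∀ {x} → KerNG B M x → IsCrossedHom B M (cocycle (oddPart x))
  cocycle-oddPart-crossed {x} NGx≈ε =
    cocycle-crossed (N-oddPart (trans (sym (NG≈N x)) NGx≈ε)) (half-antiInvariant τ-endo τ-involutive x)

  IsCoboundary : (Dih q → A) → A → Set ℓ
  IsCoboundary f b = ∀ g → f g ≈ act B M g b - b

  cocycle-coboundary : ∀ {a b} → σ b ≈ b → a ≈ ρ b - b → IsCoboundary (cocycle a) b
  cocycle-coboundary {a} {b} σb≈b a≈ (i , false) =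
    trans (≈-cong (orbitSum-endo ρ-endo (toℕ i)) a≈) (orbitSum-telescope ρ-endo (toℕ i) b)
  cocycle-coboundary {a} {b} σb≈b a≈ (i , true) =
    trans (cocycle-coboundary σb≈b a≈ (i , false)) (∙-congʳ (≈-cong (iter-endo ρ-endo (toℕ i)) (sym σb≈b)))

  cocycle∘oddPart-endo : ∀ g → IsEndo B (λ x → cocycle (oddPart x) g)
  cocycle∘oddPart-endo (i , _) = ∘-endo (orbitSum-endo ρ-endo (toℕ i)) oddPart-endo

  InvSum-resp : ∀ {x y} → x ≈ y → InvSum B M x → InvSum B M y
  InvSum-resp x≈y (u , v , σu≈u , σρv≈v , x≈u+v) = u , v , σu≈u , σρv≈v , trans (sym x≈y) x≈u+v

  InvSum-σ-invariant-∙ : ∀ {u₀ w} → σ u₀ ≈ u₀ → InvSum B M w → InvSum B M (u₀ ∙ w)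
  InvSum-σ-invariant-∙ {u₀} σu₀≈u₀ (u , v , σu≈u , σρv≈v , w≈u+v) =
    u₀ ∙ u , v , trans (∙-hom σ-endo _ _) (∙-cong σu₀≈u₀ σu≈u) , σρv≈v ,
    trans (∙-congˡ w≈u+v) (sym (assoc _ _ _))

  -- d − ρ d = − (ρ d + σ ρ d) + (d + σ ρ d), a σ-invariant plus a σρ-invariant element.
  InvSum-ρ-difference : ∀ d → InvSum B M (d - ρ d)
  InvSum-ρ-difference d = (σ (ρ d) ∙ ρ d) ⁻¹ , d ∙ σ (ρ d) , σ-fixed , σρ-fixed ,
    solve (v₀ ⊖ v₁) (⊝ (v₂ ⊕ v₁) ⊕ (v₀ ⊕ v₂)) ≡.refl (d ∷ ρ d ∷ σ (ρ d) ∷ [])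
    where
    σ-fixed : σ ((σ (ρ d) ∙ ρ d) ⁻¹) ≈ (σ (ρ d) ∙ ρ d) ⁻¹
    σ-fixed = trans (endo-⁻¹ σ-endo _)
                    (⁻¹-cong (trans (≈-cong σ-endo (comm _ _)) (trans (σ-1+σ (ρ d)) (comm _ _))))
    σρ-fixed : σ (ρ (d ∙ σ (ρ d))) ≈ d ∙ σ (ρ d)
    σρ-fixed = trans (∙-hom (∘-endo σ-endo ρ-endo) _ _) (trans (∙-congˡ (σρ-involutive d)) (comm _ _))

  InvSum⇒cocycle-coboundary : ∀ {z} → InvSum B M z → ∃[ b ] IsCoboundary (cocycle (oddPart z)) b
  InvSum⇒cocycle-coboundary {z} (u , v , σu≈u , σρv≈v , z≈u+v) = half t ⁻¹ , cocycle-coboundary σb≈b a≈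
    where
    σv≈ρv : σ v ≈ ρ v
    σv≈ρv = σρ-fixed⇒σ≈ρ σρv≈v
    t : A
    t = (u ∙ v) ∙ ρ v
    σt≈t : σ t ≈ t
    σt≈t = begin
      σ ((u ∙ v) ∙ ρ v)       ≈⟨ trans (∙-hom σ-endo _ _) (∙-congʳ (∙-hom σ-endo _ _)) ⟩
      (σ u ∙ σ v) ∙ σ (ρ v)   ≈⟨ ∙-cong (∙-cong σu≈u σv≈ρv) σρv≈v ⟩
      (u ∙ ρ v) ∙ v           ≈⟨ solve ((v₀ ⊕ v₁) ⊕ v₂) ((v₀ ⊕ v₂) ⊕ v₁) ≡.refl (u ∷ ρ v ∷ v ∷ []) ⟩
      t                       ∎
    σb≈b : σ (half t ⁻¹) ≈ half t ⁻¹
    σb≈b = trans (endo-⁻¹ σ-endo _) (⁻¹-cong (trans (sym (half-natural σ-endo t)) (≈-cong half-endo σt≈t)))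
    t-ρt≈z-τz : t - ρ t ≈ z - τ z
    t-ρt≈z-τz = begin
      t - ρ t                      ≈⟨ ∙-congˡ (⁻¹-cong (trans (∙-hom ρ-endo _ _) (∙-congʳ (∙-hom ρ-endo _ _)))) ⟩
      t - ((ρ u ∙ ρ v) ∙ ρ (ρ v))  ≈⟨ solve (((v₀ ⊕ v₁) ⊕ v₂) ⊖ ((v₃ ⊕ v₂) ⊕ v₄)) ((v₀ ⊕ v₁) ⊖ (v₃ ⊕ v₄)) ≡.refl
                                        (u ∷ v ∷ ρ v ∷ ρ u ∷ ρ (ρ v) ∷ []) ⟩
      (u ∙ v) - (ρ u ∙ ρ (ρ v))    ≈⟨ ∙-congˡ (⁻¹-cong (trans (∙-hom τ-endo _ _)
                                        (∙-cong (≈-cong ρ-endo σu≈u) (≈-cong ρ-endo σv≈ρv)))) ⟨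
      (u ∙ v) - τ (u ∙ v)          ≈⟨ ≈-cong (1-f-endo τ-endo) z≈u+v ⟨
      z - τ z                      ∎
    a≈ : oddPart z ≈ ρ (half t ⁻¹) - half t ⁻¹
    a≈ = begin
      half (z - τ z)              ≈⟨ ≈-cong half-endo t-ρt≈z-τz ⟨
      half (t - ρ t)              ≈⟨ half-natural (1-f-endo ρ-endo) t ⟩
      half t - ρ (half t)         ≈⟨ endo-difference-⁻¹ ρ-endo (half t) ⟨
      ρ (half t ⁻¹) - half t ⁻¹   ∎

  cocycle-coboundary⇒InvSum : ∀ {z b} → IsCoboundary (cocycle (oddPart z)) b → InvSum B M z
  cocycle-coboundary⇒InvSum {z} {b} cb = InvSum-resp (half-split z (σ z))
    (InvSum-σ-invariant-∙ σu₀≈u₀ (InvSum-resp w≈ (InvSum-ρ-difference (half d))))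
    where
    a≈ : oddPart z ≈ ρ b - b
    a≈ = trans (sym (trans (∙-congˡ (endo-ε ρ-endo)) (identityʳ _))) (cb (fs fz , false))
    σu₀≈u₀ : σ (half (1+σ z)) ≈ half (1+σ z)
    σu₀≈u₀ = trans (sym (half-natural σ-endo _)) (≈-cong half-endo (σ-1+σ z))
    X d : A
    X = (b ∙ b) ∙ σ z
    d = X ⁻¹
    d-ρd≈ : d - ρ d ≈ 1-σ z
    d-ρd≈ = begin
      X ⁻¹ - ρ (X ⁻¹)                      ≈⟨ ∙-congˡ (⁻¹-cong (trans (endo-⁻¹ ρ-endo X)
                                                 (⁻¹-cong (trans (∙-hom ρ-endo _ _) (∙-congʳ (∙-hom ρ-endo _ _)))))) ⟩
      X ⁻¹ - ((ρ b ∙ ρ b) ∙ τ z) ⁻¹        ≈⟨ solve (⊝ ((v₀ ⊕ v₀) ⊕ v₁) ⊖ ⊝ ((v₂ ⊕ v₂) ⊕ v₃))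
                                                 (((v₂ ⊖ v₀) ⊕ (v₂ ⊖ v₀)) ⊕ (v₃ ⊖ v₁)) ≡.refl
                                                 (b ∷ σ z ∷ ρ b ∷ τ z ∷ []) ⟩
      ((ρ b - b) ∙ (ρ b - b)) ∙ (τ z - σ z) ≈⟨ ∙-congʳ (trans (sym (half-∙-half _)) (∙-cong a≈ a≈)) ⟨
      (z - τ z) ∙ (τ z - σ z)               ≈⟨ solve ((v₀ ⊖ v₁) ⊕ (v₁ ⊖ v₂)) (v₀ ⊖ v₂) ≡.refl (z ∷ τ z ∷ σ z ∷ []) ⟩
      z - σ z                               ∎
    w≈ : half d - ρ (half d) ≈ half (z - σ z)
    w≈ = trans (sym (half-natural (1-f-endo ρ-endo) d)) (≈-cong half-endo d-ρd≈)

  module CrossedHomNormalisation {f : Dih q → A} (f-crossed : IsCrossedHom B M f) where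
    f-resp : ∀ {g g′} → g ≡ g′ → f g ≈ f g′
    f-resp = reflexive ∘ ≡.cong f

    t s : A
    t = f (fs fz , false)
    s = f (fz , true)

    f-unit : f (fz , false) ≈ ε
    f-unit = identityˡ-unique _ _ (sym (f-crossed (fz , false) (fz , false)))

    f-ρ-power : ∀ m → f (m mod q , false) ≈ orbitSum ρ m t
    f-ρ-power zero    = f-unit
    f-ρ-power (suc m) = begin
      f (suc m mod q , false)                         ≈⟨ f-resp (≡.cong (_, false) (suc-mod m)) ⟩
      f (dmul q (fs fz , false) (m mod q , false))    ≈⟨ f-crossed _ _ ⟩
      t ∙ ρ (f (m mod q , false))                     ≈⟨ ∙-congˡ (≈-cong ρ-endo (f-ρ-power m)) ⟩
      orbitSum ρ (suc m) t                            ∎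

    f-rotation : ∀ i → f (i , false) ≈ orbitSum ρ (toℕ i) t
    f-rotation i = trans (f-resp (≡.cong (_, false) (≡.sym (mod-toℕ i)))) (f-ρ-power (toℕ i))

    f-reflection : ∀ i → f (i , true) ≈ f (i , false) ∙ iter (toℕ i) ρ s
    f-reflection i =
      trans (f-resp (≡.cong (_, true) (≡.sym (≡.trans (≡.cong (_mod q) (ℕ.+-identityʳ (toℕ i))) (mod-toℕ i)))))
            (f-crossed (i , false) (fz , true))

    N-t : N t ≈ ε
    N-t = trans (sym (f-ρ-power q)) (trans (f-resp (≡.cong (_, false) mod-self)) f-unit)

    s∙σs≈ε : s ∙ σ s ≈ ε
    s∙σs≈ε = trans (sym (f-crossed (fz , true) (fz , true)))
                   (trans (f-resp (≡.cong (_, false) mod-self)) f-unit)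

    ρs∙τt≈t⁻¹∙s : ρ s ∙ τ t ≈ t ⁻¹ ∙ s
    ρs∙τt≈t⁻¹∙s = begin
      ρ s ∙ ρ (σ t)                         ≈⟨ ∙-hom ρ-endo _ _ ⟨
      ρ (s ∙ σ t)                           ≈⟨ ≈-cong ρ-endo (sym (f-crossed (fz , true) (fs fz , false))) ⟩
      ρ (f (suc k mod q , true))            ≈⟨ ≈-cong ρ-endo (f-reflection (suc k mod q)) ⟩
      ρ (f (suc k mod q , false) ∙ iter (toℕ (suc k mod q)) ρ s)
                                            ≈⟨ ≈-cong ρ-endo (∙-cong (f-ρ-power (suc k))
                                                 (reflexive (≡.cong (λ n → iter n ρ s) toℕ[q-1]))) ⟩
      ρ (orbitSum ρ (suc k) t ∙ ρ⁻¹ s)      ≈⟨ ≈-cong ρ-endo (∙-congʳ (orbitSum-pred-q N-t)) ⟩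
      ρ (ρ⁻¹ t ⁻¹ ∙ ρ⁻¹ s)                  ≈⟨ ∙-hom ρ-endo _ _ ⟩
      ρ (ρ⁻¹ t ⁻¹) ∙ ρ (ρ⁻¹ s)              ≈⟨ ∙-cong (trans (endo-⁻¹ ρ-endo _) (⁻¹-cong (ρρ⁻¹ t))) (ρρ⁻¹ s) ⟩
      t ⁻¹ ∙ s                              ∎
      where
      toℕ[q-1] : toℕ (suc k mod q) ≡ suc k
      toℕ[q-1] = ≡.trans (toℕ-mod (suc k)) (m<n⇒m%n≡m (ℕ.n<1+n (suc k)))

    hs : A
    hs = half s

    σhs≈hs⁻¹ : σ hs ≈ hs ⁻¹
    σhs≈hs⁻¹ = begin
      σ (half s)     ≈⟨ half-natural σ-endo s ⟨
      half (σ s)     ≈⟨ ≈-cong half-endo (inverseʳ-unique s (σ s) s∙σs≈ε) ⟩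
      half (s ⁻¹)    ≈⟨ endo-⁻¹ half-endo s ⟩
      half s ⁻¹      ∎

    -- Adding to f the coboundary of s/2 gives the crossed homomorphism with f(σ) = 0 and f(ρ) = x.
    x : A
    x = t ∙ (ρ hs - hs)

    τx≈x⁻¹ : τ x ≈ x ⁻¹
    τx≈x⁻¹ = begin
      τ (t ∙ (ρ hs - hs))                    ≈⟨ trans (∙-hom τ-endo _ _) (∙-congˡ (endo-− τ-endo _ _)) ⟩
      τ t ∙ (τ (ρ hs) - τ hs)                ≈⟨ ∙-congˡ (∙-cong τρhs≈ (⁻¹-cong τhs≈)) ⟩
      τ t ∙ (hs ⁻¹ - ρ hs ⁻¹)                ≈⟨ solve (v₀ ⊕ (⊝ v₁ ⊖ ⊝ v₂)) (((v₃ ⊕ v₀) ⊖ v₃) ⊕ (⊝ v₁ ⊖ ⊝ v₂)) ≡.refl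
                                                  (τ t ∷ hs ∷ ρ hs ∷ ρ s ∷ []) ⟩
      ((ρ s ∙ τ t) - ρ s) ∙ (hs ⁻¹ - ρ hs ⁻¹) ≈⟨ ∙-congʳ (∙-cong ρs∙τt≈t⁻¹∙s (⁻¹-cong ρs≈)) ⟩
      ((t ⁻¹ ∙ s) - (ρ hs ∙ ρ hs)) ∙ (hs ⁻¹ - ρ hs ⁻¹)
                                             ≈⟨ ∙-congʳ (∙-congʳ (∙-congˡ (sym (half-∙-half s)))) ⟩
      ((t ⁻¹ ∙ (hs ∙ hs)) - (ρ hs ∙ ρ hs)) ∙ (hs ⁻¹ - ρ hs ⁻¹)
                                             ≈⟨ solve (((⊝ v₀ ⊕ (v₁ ⊕ v₁)) ⊖ (v₂ ⊕ v₂)) ⊕ (⊝ v₁ ⊖ ⊝ v₂))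
                                                  (⊝ (v₀ ⊕ (v₂ ⊖ v₁))) ≡.refl (t ∷ hs ∷ ρ hs ∷ []) ⟩
      x ⁻¹                                   ∎
      where
      τρhs≈ : τ (ρ hs) ≈ hs ⁻¹
      τρhs≈ = trans (≈-cong ρ-endo (σρ hs)) (trans (ρρ⁻¹ _) σhs≈hs⁻¹)
      τhs≈ : τ hs ≈ ρ hs ⁻¹
      τhs≈ = trans (≈-cong ρ-endo σhs≈hs⁻¹) (endo-⁻¹ ρ-endo hs)
      ρs≈ : ρ s ≈ ρ hs ∙ ρ hs
      ρs≈ = trans (≈-cong ρ-endo (sym (half-∙-half s))) (∙-hom ρ-endo _ _)

    oddPart-x : oddPart x ≈ x
    oddPart-x = sym (half-unique (∙-congˡ (sym (trans (⁻¹-cong τx≈x⁻¹) (⁻¹-involutive x)))))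

    N-x : N x ≈ ε
    N-x = begin
      N (t ∙ (ρ hs - hs))      ≈⟨ trans (∙-hom N-endo _ _) (∙-congˡ (endo-− N-endo _ _)) ⟩
      N t ∙ (N (ρ hs) - N hs)  ≈⟨ ∙-cong N-t (∙-congʳ (N-ρ hs)) ⟩
      ε ∙ (N hs - N hs)        ≈⟨ trans (identityˡ _) (inverseʳ _) ⟩
      ε                        ∎

    cocycle-x : ∀ i b → cocycle (oddPart x) (i , b) ≈ f (i , false) ∙ (iter (toℕ i) ρ hs - hs)
    cocycle-x i b = begin
      orbitSum ρ (toℕ i) (oddPart x)                     ≈⟨ ≈-cong Σⁱ-endo oddPart-x ⟩
      orbitSum ρ (toℕ i) (t ∙ (ρ hs - hs))               ≈⟨ ∙-hom Σⁱ-endo _ _ ⟩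
      orbitSum ρ (toℕ i) t ∙ orbitSum ρ (toℕ i) (ρ hs - hs)
                                                         ≈⟨ ∙-cong (sym (f-rotation i))
                                                              (orbitSum-telescope ρ-endo (toℕ i) hs) ⟩
      f (i , false) ∙ (iter (toℕ i) ρ hs - hs)           ∎
      where
      Σⁱ-endo : IsEndo B (orbitSum ρ (toℕ i))
      Σⁱ-endo = orbitSum-endo ρ-endo (toℕ i)

    f-cohomologous : IsCoboundary (λ g → cocycle (oddPart x) g - f g) hs
    f-cohomologous (i , false) = trans (∙-congʳ (cocycle-x i false))
      (solve ((v₀ ⊕ v₁) ⊖ v₀) v₁ ≡.refl (f (i , false) ∷ iter (toℕ i) ρ hs - hs ∷ []))
    f-cohomologous (i , true) = begin
      cocycle (oddPart x) (i , true) - f (i , true)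
                                      ≈⟨ ∙-cong (cocycle-x i true) (⁻¹-cong (f-reflection i)) ⟩
      (f (i , false) ∙ (ρⁱ hs - hs)) - (f (i , false) ∙ ρⁱ s)
                                      ≈⟨ solve ((v₀ ⊕ (v₁ ⊖ v₂)) ⊖ (v₀ ⊕ v₃)) ((v₁ ⊖ v₃) ⊖ v₂) ≡.refl
                                           (f (i , false) ∷ ρⁱ hs ∷ hs ∷ ρⁱ s ∷ []) ⟩
      (ρⁱ hs - ρⁱ s) - hs             ≈⟨ ∙-congʳ (endo-− ρⁱ-endo _ _) ⟨
      ρⁱ (hs - s) - hs                ≈⟨ ∙-congʳ (≈-cong ρⁱ-endo hs-s≈σhs) ⟩
      ρⁱ (σ hs) - hs                  ∎
      where
      ρⁱ : A → A
      ρⁱ = iter (toℕ i) ρ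
      ρⁱ-endo : IsEndo B ρⁱ
      ρⁱ-endo = iter-endo ρ-endo (toℕ i)
      hs-s≈σhs : hs - s ≈ σ hs
      hs-s≈σhs = begin
        hs - s            ≈⟨ ∙-congˡ (⁻¹-cong (half-∙-half s)) ⟨
        hs - (hs ∙ hs)    ≈⟨ solve (v₀ ⊖ (v₀ ⊕ v₀)) (⊝ v₀) ≡.refl (hs ∷ []) ⟩
        hs ⁻¹             ≈⟨ σhs≈hs⁻¹ ⟨
        σ hs              ∎

  Quot₂≅H1 : Quot₂ B M ≅ H1 B M
  Quot₂≅H1 = record
    { to   = cocycle ∘ oddPart
    ; mem  = cocycle-oddPart-crossed
    ; cong = λ {x} {y} _ _ (x-y-inv , _) → let (b , cb) = InvSum⇒cocycle-coboundary x-y-inv in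
               b , λ g → trans (sym (endo-− (cocycle∘oddPart-endo g) x y)) (cb g)
    ; hom  = λ {x} {y} _ _ → ε , λ g → trans (x≈y⇒x∙y⁻¹≈ε (∙-hom (cocycle∘oddPart-endo g) x y))
                                             (sym (act-ε-difference g))
    ; inj  = λ {x} {y} NGx≈ε NGy≈ε (b , cb) →
               cocycle-coboundary⇒InvSum (λ g → trans (endo-− (cocycle∘oddPart-endo g) x y) (cb g)) ,
               KerNG-− NGx≈ε NGy≈ε
    ; surj = λ f-crossed → let open CrossedHomNormalisation f-crossed in
               x , trans (NG≈N x) N-x , hs , f-cohomologous
    }

lemma2p6 : ∀ {c ℓ} (q : ℕ) .{{_ : NonZero q}} → 3 ≤ q → ¬ (2 ∣ q) →
    (B : AbelianGroup c ℓ) (M : DModule B q) → UniquelyTwoDivisible B →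
    (Quot₁ B M ≅ TateHm1 B M) × (Quot₂ B M ≅ H1 B M)
lemma2p6 (suc (suc k)) _ _ B M two-divisible =
  TateCohomology.Quot₁≅TateHm1 B k M two-divisible , FirstCohomology.Quot₂≅H1 B k M two-divisible
lemma2p6 (suc zero) (s≤s ()) _ _ _ _
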